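{- For each integer $r\geq 2$ let $\mathfrak{C}_r=(\mathbb{Z};0,+,\leq,P_2^r)$ be the structure over the language $\{0,+,\leq,R_2\}$, where $R_2$ is a unary predicate symbol interpreted as $P_2^r(x)$: "$x$ is the square of an integer and $r$ does not divide $x$". Then there is a positive existential formula $\phi(x,y)$ in the language $\{0,+,R_2\}$ such that for every $r\geq 2$ and all $x,y\in\mathbb{Z}$, $\mathfrak{C}_r\models\phi(x,y)$ if and only if $x\leq y$. That is, the relation $\leq$ is uniformly positive existentially $\{0,+,R_2\}$-definable in the class of all structures $\mathfrak{C}_r$ with $r\geq 2$. -}

module Defs where

open import Data.Nat using (ℕ; suc)
open import Data.Fin using (Fin; zero; suc)
open import Data.Integer using (ℤ; +_; _*_; _+_; 0ℤ)
open import Data.Integer.Divisibility using (_∣_)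
open import Data.Product using (_×_; ∃)
open import Data.Sum using (_⊎_)
open import Relation.Nullary using (¬_)
open import Relation.Binary.PropositionalEquality using (_≡_)

P₂ : ℕ → ℤ → Set
P₂ r x = (∃ λ k → x ≡ k * k) × ¬ ((+ r) ∣ x)

data Term (n : ℕ) : Set where
  var  : Fin n → Term n
  zer  : Term n
  _⊕_  : Term n → Term n → Term n

data PEFormula (n : ℕ) : Set where
  _≐_  : Term n → Term n → PEFormula n
  R₂   : Term n → PEFormula n
  _∧_  : PEFormula n → PEFormula n → PEFormula n
  _∨_  : PEFormula n → PEFormula n → PEFormula n
  ∃'   : PEFormula (suc n) → PEFormula n

Env : ℕ → Set
Env n = Fin n → ℤ

extend : ∀ {n} → ℤ → Env n → Env (suc n)
extend a ρ zero    = a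
extend a ρ (suc i) = ρ i

evalT : ∀ {n} → Env n → Term n → ℤ
evalT ρ (var i) = ρ i
evalT ρ zer     = 0ℤ
evalT ρ (t ⊕ s) = evalT ρ t + evalT ρ s

Sat : ℕ → ∀ {n} → PEFormula n → Env n → Set
Sat r (t ≐ s) ρ = evalT ρ t ≡ evalT ρ s
Sat r (R₂ t)  ρ = P₂ r (evalT ρ t)
Sat r (φ ∧ ψ) ρ = Sat r φ ρ × Sat r ψ ρ
Sat r (φ ∨ ψ) ρ = Sat r φ ρ ⊎ Sat r ψ ρ
Sat r (∃' φ)  ρ = ∃ λ a → Sat r φ (extend a ρ)

env₂ : ℤ → ℤ → Env 2
env₂ x y zero       = x
env₂ x y (suc zero) = y

module Submission where

-- The defining formula is
--   φ(x, y) :≡ ∃ s. y + y = x + x + s ∧ "s is a sum of 16 elements t with t = 0 ∨ R₂ t".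
-- Soundness is immediate, as squares are non-negative.  Completeness needs every even
-- natural number 2n to be such a sum.  Since 2a² + 2 is a sum of four elements of {0} ∪ P₂^r
-- (a² + a² + 1 + 1, or (a - 1)² + (a + 1)² + 0 + 0 when r ∣ a²), it suffices that n - 4 is a
-- sum of four squares for n ≥ 4, i.e. Lagrange's four-square theorem.

open import Defs
open import Data.Nat using (ℕ)
open import Data.Nat as ℕ using (zero; suc; z≤n; s≤s; NonZero)
import Data.Nat.Properties as ℕP
open import Data.Nat.Divisibility
  using (divides; ∣⇒≤; m%n≡0⇒n∣m; quotient-<; ∣1⇒≡1; _∣?_) renaming (_∣_ to _∣ℕ_)
open import Data.Nat.DivMod using (_%_; _/_; m≡m%n+[m/n]*n; m%n<n; %-distribˡ-+; m*n%n≡0)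
open import Data.Nat.Primality
  using (Prime; composite; euclidsLemma; ¬prime[0]; ¬prime[1]; prime?; ¬prime⇒composite)
open import Data.Nat.Induction using (<-rec)
open import Data.Nat.Tactic.RingSolver as ℕ-Solver using ()
open import Data.Integer as ℤ using (ℤ; +_; -[1+_]; _+_; _*_; _-_; ∣_∣; 0ℤ; 1ℤ; _≤_)
import Data.Integer.Properties as ℤP
open import Data.Integer.DivMod using (_%ℕ_; _/ℕ_; a≡a%ℕn+[a/ℕn]*n; n%ℕd<d)
open import Data.Integer.Divisibility using (_∣_)
import Data.Integer.Divisibility.Signed as Signed
open import Data.Integer.Tactic.RingSolver using (solve-∀)
open import Data.Fin using (Fin; toℕ; fromℕ<) renaming (zero to fzero; suc to fsuc)
import Data.Fin.Properties as Fin
open import Data.Empty using (⊥; ⊥-elim)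
open import Data.Product using (Σ; _×_; _,_; ∃)
open import Data.Sum using (_⊎_; inj₁; inj₂; [_,_]′)
open import Function using (_∘_)
open import Function.Bundles using (_⇔_; mk⇔; Equivalence)
open import Relation.Binary.Definitions using (tri<; tri≈; tri>)
open import Relation.Binary.PropositionalEquality
open import Relation.Nullary using (¬_; Dec; yes; no)
open import Relation.Nullary.Negation using (contradiction)

record FourSquares (n : ℤ) : Set where
  constructor fourSquares
  field
    a b c d : ℤ
    sum : n ≡ a * a + b * b + c * c + d * d

euler-identity : ∀ a₁ a₂ a₃ a₄ b₁ b₂ b₃ b₄ →
  (a₁ * a₁ + a₂ * a₂ + a₃ * a₃ + a₄ * a₄) * (b₁ * b₁ + b₂ * b₂ + b₃ * b₃ + b₄ * b₄)
  ≡ (a₁ * b₁ + a₂ * b₂ + a₃ * b₃ + a₄ * b₄) * (a₁ * b₁ + a₂ * b₂ + a₃ * b₃ + a₄ * b₄)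
  + (a₁ * b₂ - a₂ * b₁ + a₃ * b₄ - a₄ * b₃) * (a₁ * b₂ - a₂ * b₁ + a₃ * b₄ - a₄ * b₃)
  + (a₁ * b₃ - a₃ * b₁ + a₄ * b₂ - a₂ * b₄) * (a₁ * b₃ - a₃ * b₁ + a₄ * b₂ - a₂ * b₄)
  + (a₁ * b₄ - a₄ * b₁ + a₂ * b₃ - a₃ * b₂) * (a₁ * b₄ - a₄ * b₁ + a₂ * b₃ - a₃ * b₂)
euler-identity = solve-∀

fourSquares-* : ∀ {m n} → FourSquares m → FourSquares n → FourSquares (m * n)
fourSquares-* (fourSquares a₁ a₂ a₃ a₄ m≡) (fourSquares b₁ b₂ b₃ b₄ n≡) =
  fourSquares (a₁ * b₁ + a₂ * b₂ + a₃ * b₃ + a₄ * b₄) (a₁ * b₂ - a₂ * b₁ + a₃ * b₄ - a₄ * b₃)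
              (a₁ * b₃ - a₃ * b₁ + a₄ * b₂ - a₂ * b₄) (a₁ * b₄ - a₄ * b₁ + a₂ * b₃ - a₃ * b₂)
              (trans (cong₂ _*_ m≡ n≡) (euler-identity a₁ a₂ a₃ a₄ b₁ b₂ b₃ b₄))

fourSquares-cancel : ∀ M .{{_ : ℤ.NonZero M}} n a b c d →
  M * (M * n) ≡ (M * a) * (M * a) + (M * b) * (M * b) + (M * c) * (M * c) + (M * d) * (M * d) →
  FourSquares n
fourSquares-cancel M n a b c d eq =
  fourSquares a b c d (ℤP.*-cancelˡ-≡ M _ _ (ℤP.*-cancelˡ-≡ M _ _ (trans eq (factor M a b c d))))
  where
  factor : ∀ M a b c d →
    (M * a) * (M * a) + (M * b) * (M * b) + (M * c) * (M * c) + (M * d) * (M * d)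
    ≡ M * (M * (a * a + b * b + c * c + d * d))
  factor = solve-∀

square-abs : ∀ i → i * i ≡ + (∣ i ∣ ℕ.* ∣ i ∣)
square-abs (+ n)    = sym (ℤP.pos-* n n)
square-abs -[1+ n ] = refl

record BalancedResidue (m : ℕ) (x : ℤ) : Set where
  constructor balanced
  field
    residue quotient : ℤ
    split    : x ≡ residue + + m * quotient
    bound    : 2 ℕ.* ∣ residue ∣ ℕ.≤ m
    extremal : 2 ℕ.* ∣ residue ∣ ≡ m → residue ≡ + ∣ residue ∣

balancedResidue : ∀ m .{{_ : NonZero m}} x → BalancedResidue m x
balancedResidue m x with 2 ℕ.* (x %ℕ m) ℕ.≤? m
... | yes 2t≤m = balanced (+ t) (x /ℕ m) split₊ 2t≤m (λ _ → refl)
  where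
  t = x %ℕ m
  split₊ : x ≡ + t + + m * (x /ℕ m)
  split₊ = trans (a≡a%ℕn+[a/ℕn]*n x m) (cong (_+_ (+ t)) (ℤP.*-comm (x /ℕ m) (+ m)))
... | no 2t≰m = balanced y (x /ℕ m + 1ℤ) split₋ (ℕP.<⇒≤ bound₋) (λ e → ⊥-elim (ℕP.<⇒≢ bound₋ e))
  where
  t = x %ℕ m
  y = + t - + m
  t<m : t ℕ.< m
  t<m = n%ℕd<d x m
  ∣y∣≡ : ∣ y ∣ ≡ m ℕ.∸ t
  ∣y∣≡ = trans (cong ∣_∣ (ℤP.m-n≡m⊖n t m)) (ℤP.∣⊖∣-< t<m)
  bound₋ : 2 ℕ.* ∣ y ∣ ℕ.< m
  bound₋ = begin-strict
    2 ℕ.* ∣ y ∣         ≡⟨ cong (2 ℕ.*_) ∣y∣≡ ⟩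
    2 ℕ.* (m ℕ.∸ t)     ≡⟨ ℕP.*-distribˡ-∸ 2 m t ⟩
    2 ℕ.* m ℕ.∸ 2 ℕ.* t <⟨ ℕP.∸-monoʳ-< (ℕP.≰⇒> 2t≰m) (ℕP.*-monoʳ-≤ 2 (ℕP.<⇒≤ t<m)) ⟩
    2 ℕ.* m ℕ.∸ m       ≡⟨ cong (λ k → m ℕ.+ k ℕ.∸ m) (ℕP.+-identityʳ m) ⟩
    m ℕ.+ m ℕ.∸ m       ≡⟨ ℕP.m+n∸m≡n m m ⟩
    m                   ∎
    where open ℕP.≤-Reasoning
  shift : ∀ t M Q → t + Q * M ≡ (t - M) + M * (Q + 1ℤ)
  shift = solve-∀
  split₋ : x ≡ y + + m * (x /ℕ m + 1ℤ)
  split₋ = trans (a≡a%ℕn+[a/ℕn]*n x m) (shift (+ t) (+ m) (x /ℕ m))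

residue-cofactor : ∀ y₁ y₂ y₃ y₄ q₁ q₂ q₃ q₄ M P →
  M * P ≡ (y₁ + M * q₁) * (y₁ + M * q₁) + (y₂ + M * q₂) * (y₂ + M * q₂)
        + (y₃ + M * q₃) * (y₃ + M * q₃) + (y₄ + M * q₄) * (y₄ + M * q₄) →
  y₁ * y₁ + y₂ * y₂ + y₃ * y₃ + y₄ * y₄
  ≡ M * (P - ((y₁ * q₁ + y₂ * q₂ + y₃ * q₃ + y₄ * q₄) + (y₁ * q₁ + y₂ * q₂ + y₃ * q₃ + y₄ * q₄)
              + M * (q₁ * q₁ + q₂ * q₂ + q₃ * q₃ + q₄ * q₄)))
residue-cofactor y₁ y₂ y₃ y₄ q₁ q₂ q₃ q₄ M P mp≡ =
  trans (expand y₁ y₂ y₃ y₄ q₁ q₂ q₃ q₄ M) (trans (cong (_- _) (sym mp≡)) (factor M P _))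
  where
  expand : ∀ y₁ y₂ y₃ y₄ q₁ q₂ q₃ q₄ M →
    y₁ * y₁ + y₂ * y₂ + y₃ * y₃ + y₄ * y₄
    ≡ ((y₁ + M * q₁) * (y₁ + M * q₁) + (y₂ + M * q₂) * (y₂ + M * q₂)
       + (y₃ + M * q₃) * (y₃ + M * q₃) + (y₄ + M * q₄) * (y₄ + M * q₄))
      - M * ((y₁ * q₁ + y₂ * q₂ + y₃ * q₃ + y₄ * q₄) + (y₁ * q₁ + y₂ * q₂ + y₃ * q₃ + y₄ * q₄)
             + M * (q₁ * q₁ + q₂ * q₂ + q₃ * q₃ + q₄ * q₄))
  expand = solve-∀
  factor : ∀ M P L → M * P - M * L ≡ M * (P - L)
  factor = solve-∀

-- Euler's identity applied to xᵢ = yᵢ + M qᵢ and to the yᵢ: when Σ xᵢ² = M P and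
-- Σ yᵢ² = M R, all four terms of the product are multiples of M, so R P is a sum of
-- four squares.
reduced-fourSquares : ∀ y₁ y₂ y₃ y₄ q₁ q₂ q₃ q₄ M .{{_ : ℤ.NonZero M}} P R →
  M * P ≡ (y₁ + M * q₁) * (y₁ + M * q₁) + (y₂ + M * q₂) * (y₂ + M * q₂)
        + (y₃ + M * q₃) * (y₃ + M * q₃) + (y₄ + M * q₄) * (y₄ + M * q₄) →
  y₁ * y₁ + y₂ * y₂ + y₃ * y₃ + y₄ * y₄ ≡ M * R →
  FourSquares (R * P)
reduced-fourSquares y₁ y₂ y₃ y₄ q₁ q₂ q₃ q₄ M P R mp≡ mr≡ =
  fourSquares-cancel M (R * P) (R + Q) w₂ w₃ w₄ (begin
    M * (M * (R * P))                ≡⟨ regroup M P R ⟩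
    (M * P) * (M * R)                ≡⟨ cong₂ _*_ mp≡ (sym mr≡) ⟩
    _                                ≡⟨ euler y₁ y₂ y₃ y₄ q₁ q₂ q₃ q₄ M ⟩
    (S + M * Q) * (S + M * Q) + W₂ + W₃ + W₄
                                     ≡⟨ cong (λ s → (s + M * Q) * (s + M * Q) + W₂ + W₃ + W₄) mr≡ ⟩
    (M * R + M * Q) * (M * R + M * Q) + W₂ + W₃ + W₄
                                     ≡⟨ cong (λ s → s * s + W₂ + W₃ + W₄) (sym (ℤP.*-distribˡ-+ M R Q)) ⟩
    (M * (R + Q)) * (M * (R + Q)) + W₂ + W₃ + W₄ ∎)
  where
  open ≡-Reasoning
  S Q w₂ w₃ w₄ W₂ W₃ W₄ : ℤ
  S  = y₁ * y₁ + y₂ * y₂ + y₃ * y₃ + y₄ * y₄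
  Q  = q₁ * y₁ + q₂ * y₂ + q₃ * y₃ + q₄ * y₄
  w₂ = q₁ * y₂ - q₂ * y₁ + q₃ * y₄ - q₄ * y₃
  w₃ = q₁ * y₃ - q₃ * y₁ + q₄ * y₂ - q₂ * y₄
  w₄ = q₁ * y₄ - q₄ * y₁ + q₂ * y₃ - q₃ * y₂
  W₂ = (M * w₂) * (M * w₂)
  W₃ = (M * w₃) * (M * w₃)
  W₄ = (M * w₄) * (M * w₄)
  regroup : ∀ M P R → M * (M * (R * P)) ≡ (M * P) * (M * R)
  regroup = solve-∀
  euler : ∀ y₁ y₂ y₃ y₄ q₁ q₂ q₃ q₄ M →
    ((y₁ + M * q₁) * (y₁ + M * q₁) + (y₂ + M * q₂) * (y₂ + M * q₂)
     + (y₃ + M * q₃) * (y₃ + M * q₃) + (y₄ + M * q₄) * (y₄ + M * q₄))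
    * (y₁ * y₁ + y₂ * y₂ + y₃ * y₃ + y₄ * y₄)
    ≡ (y₁ * y₁ + y₂ * y₂ + y₃ * y₃ + y₄ * y₄ + M * (q₁ * y₁ + q₂ * y₂ + q₃ * y₃ + q₄ * y₄))
      * (y₁ * y₁ + y₂ * y₂ + y₃ * y₃ + y₄ * y₄ + M * (q₁ * y₁ + q₂ * y₂ + q₃ * y₃ + q₄ * y₄))
    + (M * (q₁ * y₂ - q₂ * y₁ + q₃ * y₄ - q₄ * y₃)) * (M * (q₁ * y₂ - q₂ * y₁ + q₃ * y₄ - q₄ * y₃))
    + (M * (q₁ * y₃ - q₃ * y₁ + q₄ * y₂ - q₂ * y₄)) * (M * (q₁ * y₃ - q₃ * y₁ + q₄ * y₂ - q₂ * y₄))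
    + (M * (q₁ * y₄ - q₄ * y₁ + q₂ * y₃ - q₃ * y₂)) * (M * (q₁ * y₄ - q₄ * y₁ + q₂ * y₃ - q₃ * y₂))
  euler = solve-∀

zero-residues : ∀ y₁ y₂ y₃ y₄ q₁ q₂ q₃ q₄ M →
  y₁ ≡ 0ℤ → y₂ ≡ 0ℤ → y₃ ≡ 0ℤ → y₄ ≡ 0ℤ →
  (y₁ + M * q₁) * (y₁ + M * q₁) + (y₂ + M * q₂) * (y₂ + M * q₂)
  + (y₃ + M * q₃) * (y₃ + M * q₃) + (y₄ + M * q₄) * (y₄ + M * q₄)
  ≡ M * (M * (q₁ * q₁ + q₂ * q₂ + q₃ * q₃ + q₄ * q₄))
zero-residues _ _ _ _ q₁ q₂ q₃ q₄ M refl refl refl refl = expand q₁ q₂ q₃ q₄ M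
  where
  expand : ∀ q₁ q₂ q₃ q₄ M →
    (0ℤ + M * q₁) * (0ℤ + M * q₁) + (0ℤ + M * q₂) * (0ℤ + M * q₂)
    + (0ℤ + M * q₃) * (0ℤ + M * q₃) + (0ℤ + M * q₄) * (0ℤ + M * q₄)
    ≡ M * (M * (q₁ * q₁ + q₂ * q₂ + q₃ * q₃ + q₄ * q₄))
  expand = solve-∀

half-residues : ∀ y₁ y₂ y₃ y₄ q₁ q₂ q₃ q₄ M →
  y₁ + y₁ ≡ M → y₂ + y₂ ≡ M → y₃ + y₃ ≡ M → y₄ + y₄ ≡ M →
  + 4 * ((y₁ + M * q₁) * (y₁ + M * q₁) + (y₂ + M * q₂) * (y₂ + M * q₂)
         + (y₃ + M * q₃) * (y₃ + M * q₃) + (y₄ + M * q₄) * (y₄ + M * q₄))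
  ≡ + 4 * (M * (M * (1ℤ + (q₁ + q₁ * q₁) + (q₂ + q₂ * q₂) + (q₃ + q₃ * q₃) + (q₄ + q₄ * q₄))))
half-residues y₁ y₂ y₃ y₄ q₁ q₂ q₃ q₄ M h₁ h₂ h₃ h₄ =
  trans (double y₁ y₂ y₃ y₄ q₁ q₂ q₃ q₄ M) (trans (at-half h₁ h₂ h₃ h₄) (expand q₁ q₂ q₃ q₄ M))
  where
  double : ∀ y₁ y₂ y₃ y₄ q₁ q₂ q₃ q₄ M →
    + 4 * ((y₁ + M * q₁) * (y₁ + M * q₁) + (y₂ + M * q₂) * (y₂ + M * q₂)
           + (y₃ + M * q₃) * (y₃ + M * q₃) + (y₄ + M * q₄) * (y₄ + M * q₄))
    ≡ ((y₁ + y₁) + (M * q₁ + M * q₁)) * ((y₁ + y₁) + (M * q₁ + M * q₁))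
    + ((y₂ + y₂) + (M * q₂ + M * q₂)) * ((y₂ + y₂) + (M * q₂ + M * q₂))
    + ((y₃ + y₃) + (M * q₃ + M * q₃)) * ((y₃ + y₃) + (M * q₃ + M * q₃))
    + ((y₄ + y₄) + (M * q₄ + M * q₄)) * ((y₄ + y₄) + (M * q₄ + M * q₄))
  double = solve-∀
  at-half : ∀ {u₁ u₂ u₃ u₄} → u₁ ≡ M → u₂ ≡ M → u₃ ≡ M → u₄ ≡ M →
    (u₁ + (M * q₁ + M * q₁)) * (u₁ + (M * q₁ + M * q₁)) + (u₂ + (M * q₂ + M * q₂)) * (u₂ + (M * q₂ + M * q₂))
    + (u₃ + (M * q₃ + M * q₃)) * (u₃ + (M * q₃ + M * q₃)) + (u₄ + (M * q₄ + M * q₄)) * (u₄ + (M * q₄ + M * q₄))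
    ≡ (M + (M * q₁ + M * q₁)) * (M + (M * q₁ + M * q₁)) + (M + (M * q₂ + M * q₂)) * (M + (M * q₂ + M * q₂))
    + (M + (M * q₃ + M * q₃)) * (M + (M * q₃ + M * q₃)) + (M + (M * q₄ + M * q₄)) * (M + (M * q₄ + M * q₄))
  at-half refl refl refl refl = refl
  expand : ∀ q₁ q₂ q₃ q₄ M →
    (M + (M * q₁ + M * q₁)) * (M + (M * q₁ + M * q₁)) + (M + (M * q₂ + M * q₂)) * (M + (M * q₂ + M * q₂))
    + (M + (M * q₃ + M * q₃)) * (M + (M * q₃ + M * q₃)) + (M + (M * q₄ + M * q₄)) * (M + (M * q₄ + M * q₄))
    ≡ + 4 * (M * (M * (1ℤ + (q₁ + q₁ * q₁) + (q₂ + q₂ * q₂) + (q₃ + q₃ * q₃) + (q₄ + q₄ * q₄))))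
  expand = solve-∀

cong₄ : ∀ {A B : Set} (f : A → A → A → A → B) {a₁ a₂ a₃ a₄ b₁ b₂ b₃ b₄} →
  a₁ ≡ b₁ → a₂ ≡ b₂ → a₃ ≡ b₃ → a₄ ≡ b₄ → f a₁ a₂ a₃ a₄ ≡ f b₁ b₂ b₃ b₄
cong₄ f refl refl refl refl = refl

sum-tight : ∀ {a b A B} → a ℕ.≤ A → b ℕ.≤ B → a ℕ.+ b ≡ A ℕ.+ B → a ≡ A × b ≡ B
sum-tight a≤A b≤B eq with ℕP.m≤n⇒m<n∨m≡n a≤A | ℕP.m≤n⇒m<n∨m≡n b≤B
... | inj₁ a<A | _        = ⊥-elim (ℕP.<⇒≢ (ℕP.+-mono-<-≤ a<A b≤B) eq)
... | inj₂ a≡A | inj₁ b<B = ⊥-elim (ℕP.<⇒≢ (ℕP.+-mono-≤-< a≤A b<B) eq)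
... | inj₂ a≡A | inj₂ b≡B = a≡A , b≡B

sum-tight₄ : ∀ {a₁ a₂ a₃ a₄ A₁ A₂ A₃ A₄} →
  a₁ ℕ.≤ A₁ → a₂ ℕ.≤ A₂ → a₃ ℕ.≤ A₃ → a₄ ℕ.≤ A₄ →
  a₁ ℕ.+ a₂ ℕ.+ a₃ ℕ.+ a₄ ≡ A₁ ℕ.+ A₂ ℕ.+ A₃ ℕ.+ A₄ →
  a₁ ≡ A₁ × a₂ ≡ A₂ × a₃ ≡ A₃ × a₄ ≡ A₄
sum-tight₄ le₁ le₂ le₃ le₄ eq =
  let le₁₂ = ℕP.+-mono-≤ le₁ le₂
      (eq₁₂₃ , eq₄) = sum-tight (ℕP.+-mono-≤ le₁₂ le₃) le₄ eq
      (eq₁₂ , eq₃)  = sum-tight le₁₂ le₃ eq₁₂₃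
      (eq₁ , eq₂)   = sum-tight le₁ le₂ eq₁₂
  in eq₁ , eq₂ , eq₃ , eq₄

square-injective : ∀ x y → x ℕ.* x ≡ y ℕ.* y → x ≡ y
square-injective x y eq with ℕP.<-cmp x y
... | tri< x<y _ _ = ⊥-elim (ℕP.<⇒≢ (ℕP.*-mono-< x<y x<y) eq)
... | tri≈ _ x≡y _ = x≡y
... | tri> _ _ y<x = ⊥-elim (ℕP.<⇒≢ (ℕP.*-mono-< y<x y<x) (sym eq))

four-squares-doubled : ∀ a b c d →
  (2 ℕ.* a) ℕ.* (2 ℕ.* a) ℕ.+ (2 ℕ.* b) ℕ.* (2 ℕ.* b) ℕ.+ (2 ℕ.* c) ℕ.* (2 ℕ.* c) ℕ.+ (2 ℕ.* d) ℕ.* (2 ℕ.* d)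
  ≡ 4 ℕ.* (a ℕ.* a ℕ.+ b ℕ.* b ℕ.+ c ℕ.* c ℕ.+ d ℕ.* d)
four-squares-doubled = ℕ-Solver.solve-∀

four-times : ∀ n → n ℕ.+ n ℕ.+ n ℕ.+ n ≡ 4 ℕ.* n
four-times = ℕ-Solver.solve-∀

nonneg-cofactor : ∀ {m N} R .{{_ : NonZero m}} → + N ≡ + m * R → R ≡ + ∣ R ∣
nonneg-cofactor (+ n) _ = refl
nonneg-cofactor {suc m} -[1+ n ] ()
nonneg-cofactor {zero} -[1+ n ] _ = ⊥-elim (ℕ.≢-nonZero⁻¹ zero refl)

multiple⇒∣ : ∀ m p K → + p ≡ + m * K → m ∣ℕ p
multiple⇒∣ m p K eq = divides ∣ K ∣ (trans (cong ∣_∣ eq) (trans (ℤP.abs-* (+ m) K) (ℕP.*-comm m ∣ K ∣)))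

module Descent (p : ℕ) (prime-p : Prime p) where

  no-proper-divisor : ∀ {m} → 1 ℕ.< m → m ℕ.< p → ¬ (m ∣ℕ p)
  no-proper-divisor 1<m m<p m∣p = Prime.notComposite prime-p (composite m<p m∣p)
    where instance _ = ℕ.n>1⇒nonTrivial 1<m

  -- The reduction of a representation mp = Σ xᵢ² (1 < m < p): with balanced residues
  -- xᵢ = yᵢ + m qᵢ one has Σ yᵢ² = m r, and r p is again a sum of four squares with
  -- 0 < r < m, because r = 0 or r = m would make m a divisor of p.
  module Reduction {m : ℕ} (1<m : 1 ℕ.< m) (m<p : m ℕ.< p) (mp : FourSquares (+ m * + p)) where

    instance
      m-nonZero : NonZero m
      m-nonZero = ℕ.>-nonZero (ℕP.<-trans (s≤s z≤n) 1<m)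

    open FourSquares mp renaming (a to x₁; b to x₂; c to x₃; d to x₄; sum to mp≡)
    open BalancedResidue (balancedResidue m x₁)
      renaming (residue to y₁; quotient to q₁; split to split₁; bound to bound₁; extremal to extremal₁)
    open BalancedResidue (balancedResidue m x₂)
      renaming (residue to y₂; quotient to q₂; split to split₂; bound to bound₂; extremal to extremal₂)
    open BalancedResidue (balancedResidue m x₃)
      renaming (residue to y₃; quotient to q₃; split to split₃; bound to bound₃; extremal to extremal₃)
    open BalancedResidue (balancedResidue m x₄)
      renaming (residue to y₄; quotient to q₄; split to split₄; bound to bound₄; extremal to extremal₄)

    M : ℤ
    M = + m

    mp≡residues : M * + p ≡ (y₁ + M * q₁) * (y₁ + M * q₁) + (y₂ + M * q₂) * (y₂ + M * q₂)
                          + (y₃ + M * q₃) * (y₃ + M * q₃) + (y₄ + M * q₄) * (y₄ + M * q₄)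
    mp≡residues = trans mp≡ (cong₄ (λ a b c d → a * a + b * b + c * c + d * d) split₁ split₂ split₃ split₄)

    R : ℤ
    R = + p - ((y₁ * q₁ + y₂ * q₂ + y₃ * q₃ + y₄ * q₄) + (y₁ * q₁ + y₂ * q₂ + y₃ * q₃ + y₄ * q₄)
               + M * (q₁ * q₁ + q₂ * q₂ + q₃ * q₃ + q₄ * q₄))

    residues≡ : y₁ * y₁ + y₂ * y₂ + y₃ * y₃ + y₄ * y₄ ≡ M * R
    residues≡ = residue-cofactor y₁ y₂ y₃ y₄ q₁ q₂ q₃ q₄ M (+ p) mp≡residues

    a₁ a₂ a₃ a₄ N r : ℕ
    a₁ = ∣ y₁ ∣
    a₂ = ∣ y₂ ∣
    a₃ = ∣ y₃ ∣
    a₄ = ∣ y₄ ∣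
    N  = a₁ ℕ.* a₁ ℕ.+ a₂ ℕ.* a₂ ℕ.+ a₃ ℕ.* a₃ ℕ.+ a₄ ℕ.* a₄
    r  = ∣ R ∣

    N≡mR : + N ≡ M * R
    N≡mR = trans (sym (cong₄ (λ a b c d → a + b + c + d)
                        (square-abs y₁) (square-abs y₂) (square-abs y₃) (square-abs y₄))) residues≡

    N≡mr : N ≡ m ℕ.* r
    N≡mr = trans (cong ∣_∣ N≡mR) (ℤP.abs-* M R)

    doubled≡ : (2 ℕ.* a₁) ℕ.* (2 ℕ.* a₁) ℕ.+ (2 ℕ.* a₂) ℕ.* (2 ℕ.* a₂)
               ℕ.+ (2 ℕ.* a₃) ℕ.* (2 ℕ.* a₃) ℕ.+ (2 ℕ.* a₄) ℕ.* (2 ℕ.* a₄) ≡ 4 ℕ.* (m ℕ.* r)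
    doubled≡ = trans (four-squares-doubled a₁ a₂ a₃ a₄) (cong (4 ℕ.*_) N≡mr)

    sq : ∀ {a} → a ℕ.≤ m → a ℕ.* a ℕ.≤ m ℕ.* m
    sq a≤m = ℕP.*-mono-≤ a≤m a≤m

    -- Since |yᵢ| ≤ m/2, we have 4 m r = Σ (2|yᵢ|)² ≤ 4 m², hence r ≤ m.
    r≤m : r ℕ.≤ m
    r≤m = ℕP.*-cancelˡ-≤ m (ℕP.*-cancelˡ-≤ 4 (begin
      4 ℕ.* (m ℕ.* r)  ≡⟨ sym doubled≡ ⟩
      _                ≤⟨ ℕP.+-mono-≤ (ℕP.+-mono-≤ (ℕP.+-mono-≤ (sq bound₁) (sq bound₂)) (sq bound₃)) (sq bound₄) ⟩
      m ℕ.* m ℕ.+ m ℕ.* m ℕ.+ m ℕ.* m ℕ.+ m ℕ.* m ≡⟨ four-times (m ℕ.* m) ⟩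
      4 ℕ.* (m ℕ.* m)  ∎))
      where open ℕP.≤-Reasoning

    -- A representation M p = M (M K) would make m a proper divisor of p.
    not-multiple : ∀ K → M * + p ≡ M * (M * K) → ⊥
    not-multiple K eq = no-proper-divisor 1<m m<p (multiple⇒∣ m p K (ℤP.*-cancelˡ-≡ M (+ p) (M * K) eq))

    -- r = 0 forces every residue to vanish, so m² divides mp.
    r≢0 : r ≢ 0
    r≢0 r≡0 =
      let (t₁ , t₂ , t₃ , t₄) = sum-tight₄ z≤n z≤n z≤n z≤n N≡0
      in not-multiple _ (trans mp≡residues (zero-residues y₁ y₂ y₃ y₄ q₁ q₂ q₃ q₄ M
                           (vanish y₁ t₁) (vanish y₂ t₂) (vanish y₃ t₃) (vanish y₄ t₄)))
      where
      N≡0 : 0 ≡ N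
      N≡0 = sym (trans N≡mr (trans (cong (m ℕ.*_) r≡0) (ℕP.*-zeroʳ m)))
      vanish : ∀ y → 0 ≡ ∣ y ∣ ℕ.* ∣ y ∣ → y ≡ 0ℤ
      vanish y e = ℤP.∣i∣≡0⇒i≡0 (square-injective _ 0 (sym e))

    -- r = m forces every |yᵢ| = m/2, hence yᵢ = m/2 and m² divides mp.
    r≢m : r ≢ m
    r≢m r≡m =
      let (t₁ , t₂ , t₃ , t₄) = sum-tight₄ (sq bound₁) (sq bound₂) (sq bound₃) (sq bound₄) extreme
      in not-multiple _ (ℤP.*-cancelˡ-≡ (+ 4) _ _ (trans (cong (+ 4 *_) mp≡residues)
           (half-residues y₁ y₂ y₃ y₄ q₁ q₂ q₃ q₄ M
              (half extremal₁ t₁) (half extremal₂ t₂) (half extremal₃ t₃) (half extremal₄ t₄))))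
      where
      extreme : (2 ℕ.* a₁) ℕ.* (2 ℕ.* a₁) ℕ.+ (2 ℕ.* a₂) ℕ.* (2 ℕ.* a₂)
                ℕ.+ (2 ℕ.* a₃) ℕ.* (2 ℕ.* a₃) ℕ.+ (2 ℕ.* a₄) ℕ.* (2 ℕ.* a₄)
                ≡ m ℕ.* m ℕ.+ m ℕ.* m ℕ.+ m ℕ.* m ℕ.+ m ℕ.* m
      extreme = trans doubled≡ (trans (cong (λ k → 4 ℕ.* (m ℕ.* k)) r≡m) (sym (four-times (m ℕ.* m))))
      half : ∀ {y} → (2 ℕ.* ∣ y ∣ ≡ m → y ≡ + ∣ y ∣) →
             (2 ℕ.* ∣ y ∣) ℕ.* (2 ℕ.* ∣ y ∣) ≡ m ℕ.* m → y + y ≡ M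
      half {y} ext e = begin
        y + y                  ≡⟨ cong₂ _+_ (ext 2a≡m) (ext 2a≡m) ⟩
        + (∣ y ∣ ℕ.+ ∣ y ∣)     ≡⟨ cong (λ k → + (∣ y ∣ ℕ.+ k)) (sym (ℕP.+-identityʳ ∣ y ∣)) ⟩
        + (2 ℕ.* ∣ y ∣)        ≡⟨ cong +_ 2a≡m ⟩
        M                      ∎
        where
        open ≡-Reasoning
        2a≡m = square-injective _ _ e

    reduced : FourSquares (+ r * + p)
    reduced = subst (λ k → FourSquares (k * + p)) (nonneg-cofactor R N≡mR)
                    (reduced-fourSquares y₁ y₂ y₃ y₄ q₁ q₂ q₃ q₄ M (+ p) R mp≡residues residues≡)

  descent-step : ∀ {m} → 1 ℕ.< m → m ℕ.< p → FourSquares (+ m * + p) →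
                 ∃ λ r → 0 ℕ.< r × r ℕ.< m × FourSquares (+ r * + p)
  descent-step 1<m m<p mp = r , ℕP.n≢0⇒n>0 r≢0 , ℕP.≤∧≢⇒< r≤m r≢m , reduced
    where open Reduction 1<m m<p mp

  descent : ∀ m → 0 ℕ.< m → m ℕ.< p → FourSquares (+ m * + p) → FourSquares (+ p)
  descent = <-rec (λ m → 0 ℕ.< m → m ℕ.< p → FourSquares (+ m * + p) → FourSquares (+ p)) step
    where
    step : ∀ m → (∀ {k} → k ℕ.< m → 0 ℕ.< k → k ℕ.< p → FourSquares (+ k * + p) → FourSquares (+ p)) →
           0 ℕ.< m → m ℕ.< p → FourSquares (+ m * + p) → FourSquares (+ p)
    step m descend 0<m m<p mp with m ℕ.≟ 1
    ... | yes refl = subst FourSquares (ℤP.*-identityˡ (+ p)) mp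
    ... | no m≢1   =
      let (r , 0<r , r<m , rp) = descent-step (ℕP.≤∧≢⇒< 0<m (m≢1 ∘ sym)) m<p mp
      in descend r<m 0<r (ℕP.<-trans r<m m<p) rp

same-remainder⇒∣ : ∀ n .{{_ : NonZero n}} a k → a % n ≡ (a ℕ.+ k) % n → n ∣ℕ k
same-remainder⇒∣ n a k eq = divides (B ℕ.∸ A) (begin
  k                             ≡⟨ sym (ℕP.m+n∸m≡n (A ℕ.* n) k) ⟩
  A ℕ.* n ℕ.+ k ℕ.∸ A ℕ.* n     ≡⟨ cong (ℕ._∸ A ℕ.* n) quotients ⟩
  B ℕ.* n ℕ.∸ A ℕ.* n           ≡⟨ sym (ℕP.*-distribʳ-∸ n B A) ⟩
  (B ℕ.∸ A) ℕ.* n               ∎)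
  where
  open ≡-Reasoning
  A = a / n
  B = (a ℕ.+ k) / n
  quotients : A ℕ.* n ℕ.+ k ≡ B ℕ.* n
  quotients = ℕP.+-cancelˡ-≡ (a % n) _ _ (begin
    a % n ℕ.+ (A ℕ.* n ℕ.+ k)   ≡⟨ sym (ℕP.+-assoc (a % n) (A ℕ.* n) k) ⟩
    a % n ℕ.+ A ℕ.* n ℕ.+ k     ≡⟨ cong (ℕ._+ k) (sym (m≡m%n+[m/n]*n a n)) ⟩
    a ℕ.+ k                     ≡⟨ m≡m%n+[m/n]*n (a ℕ.+ k) n ⟩
    (a ℕ.+ k) % n ℕ.+ B ℕ.* n   ≡⟨ cong (ℕ._+ B ℕ.* n) (sym eq) ⟩
    a % n ℕ.+ B ℕ.* n           ∎)

-- For an odd prime p = 2h + 1 there are x, y ≤ h with p ∣ x² + y² + 1: the h + 1 values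
-- x² (x ≤ h) are pairwise incongruent mod p, as are the h + 1 values 2h (y² + 1) ≡ -(y² + 1),
-- so by the pigeonhole principle on these 2h + 2 = p + 1 values a square meets a -(y² + 1).
module SquaresModOddPrime (h : ℕ) (prime-p : Prime (suc (h ℕ.+ h))) where

  p : ℕ
  p = suc (h ℕ.+ h)

  h≥1 : 1 ℕ.≤ h
  h≥1 = ℕP.n≢0⇒n>0 λ h≡0 → ¬prime[1] (subst (λ k → Prime (suc (k ℕ.+ k))) h≡0 prime-p)

  not-∣-small : ∀ {n} → 0 ℕ.< n → n ℕ.< p → ¬ (p ∣ℕ n)
  not-∣-small {suc n} _ n<p p∣n = ℕP.<⇒≱ n<p (∣⇒≤ p∣n)

  -- For u < v ≤ h the gap v² - u² = (v - u)(v + u) is not divisible by p.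
  squares-gap : ∀ {u v} → u ℕ.< v → v ℕ.≤ h → Σ ℕ λ g → v ℕ.* v ≡ u ℕ.* u ℕ.+ g × ¬ (p ∣ℕ g)
  squares-gap {u} {v} u<v v≤h = d ℕ.* (u ℕ.+ v) , gap , not-∣
    where
    d = v ℕ.∸ u
    v≡u+d : v ≡ u ℕ.+ d
    v≡u+d = sym (ℕP.m+[n∸m]≡n (ℕP.<⇒≤ u<v))
    expand : ∀ u d → (u ℕ.+ d) ℕ.* (u ℕ.+ d) ≡ u ℕ.* u ℕ.+ d ℕ.* (u ℕ.+ (u ℕ.+ d))
    expand = ℕ-Solver.solve-∀
    gap : v ℕ.* v ≡ u ℕ.* u ℕ.+ d ℕ.* (u ℕ.+ v)
    gap = begin
      v ℕ.* v                            ≡⟨ cong (λ w → w ℕ.* w) v≡u+d ⟩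
      (u ℕ.+ d) ℕ.* (u ℕ.+ d)            ≡⟨ expand u d ⟩
      u ℕ.* u ℕ.+ d ℕ.* (u ℕ.+ (u ℕ.+ d)) ≡⟨ cong (λ w → u ℕ.* u ℕ.+ d ℕ.* (u ℕ.+ w)) (sym v≡u+d) ⟩
      u ℕ.* u ℕ.+ d ℕ.* (u ℕ.+ v)         ∎
      where open ≡-Reasoning
    not-∣ : ¬ (p ∣ℕ d ℕ.* (u ℕ.+ v))
    not-∣ p∣ with euclidsLemma d (u ℕ.+ v) prime-p p∣
    ... | inj₁ p∣d   = not-∣-small (ℕP.m<n⇒0<n∸m u<v)
                         (s≤s (ℕP.≤-trans (ℕP.m∸n≤m v u) (ℕP.≤-trans v≤h (ℕP.m≤m+n h h)))) p∣d
    ... | inj₂ p∣u+v = not-∣-small (ℕP.<-≤-trans (ℕP.≤-<-trans z≤n u<v) (ℕP.m≤n+m v u))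
                         (s≤s (ℕP.+-mono-≤ (ℕP.≤-trans (ℕP.<⇒≤ u<v) v≤h) v≤h)) p∣u+v

  scaled-gap : ∀ {u v g} → v ℕ.* v ≡ u ℕ.* u ℕ.+ g →
    (h ℕ.+ h) ℕ.* (v ℕ.* v ℕ.+ 1) ≡ (h ℕ.+ h) ℕ.* (u ℕ.* u ℕ.+ 1) ℕ.+ (h ℕ.+ h) ℕ.* g
  scaled-gap {u} {v} {g} v²≡ = trans (cong (λ w → (h ℕ.+ h) ℕ.* (w ℕ.+ 1)) v²≡) (distribute (h ℕ.+ h) (u ℕ.* u) g)
    where
    distribute : ∀ c s g → c ℕ.* (s ℕ.+ g ℕ.+ 1) ≡ c ℕ.* (s ℕ.+ 1) ℕ.+ c ℕ.* g
    distribute = ℕ-Solver.solve-∀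

  v≤h : ∀ {b} → b ℕ.≤ p → b ℕ.∸ suc h ℕ.≤ h
  v≤h {b} b≤p = subst (b ℕ.∸ suc h ℕ.≤_) (ℕP.m+n∸m≡n h h) (ℕP.∸-monoˡ-≤ (suc h) b≤p)

  value′ : (k : ℕ) → Dec (k ℕ.≤ h) → ℕ
  value′ k (yes _) = k ℕ.* k
  value′ k (no _)  = (h ℕ.+ h) ℕ.* ((k ℕ.∸ suc h) ℕ.* (k ℕ.∸ suc h) ℕ.+ 1)

  value : ℕ → ℕ
  value k = value′ k (k ℕ.≤? h)

  Solution : Set
  Solution = ∃ λ x → ∃ λ y → x ℕ.≤ h × y ℕ.≤ h × p ∣ℕ x ℕ.* x ℕ.+ (y ℕ.* y ℕ.+ 1)

  -- Two of these values with equal remainders mod p must be a square x² and a value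
  -- 2h (y² + 1); then x² + y² + 1 ≡ x² + (2h + 1)(y² + 1) - 2h (y² + 1) ≡ 0.
  collision : ∀ a b → a ℕ.< b → b ℕ.≤ p → value a % p ≡ value b % p → Solution
  collision a b a<b b≤p with a ℕ.≤? h | b ℕ.≤? h
  ... | yes a≤h | yes b≤h = λ same →
    let (g , b²≡ , p∤g) = squares-gap a<b b≤h
    in contradiction (same-remainder⇒∣ p (a ℕ.* a) g (trans same (cong (_% p) b²≡))) p∤g
  ... | no a≰h  | yes b≤h = -- impossible, as h < a < b ≤ h
    contradiction (ℕP.<-≤-trans (ℕP.<-trans (ℕP.≰⇒> a≰h) a<b) b≤h) (ℕP.<-irrefl refl)
  ... | no a≰h  | no _    = λ same →
    let u = a ℕ.∸ suc h
        (g , v²≡ , p∤g) = squares-gap {u} {b ℕ.∸ suc h} (ℕP.∸-monoˡ-< a<b (ℕP.≰⇒> a≰h)) (v≤h b≤p)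
        p∣2hg = same-remainder⇒∣ p ((h ℕ.+ h) ℕ.* (u ℕ.* u ℕ.+ 1)) ((h ℕ.+ h) ℕ.* g)
                  (trans same (cong (_% p) (scaled-gap {u} {b ℕ.∸ suc h} v²≡)))
    in ⊥-elim ([ not-∣-small (ℕP.<-≤-trans h≥1 (ℕP.m≤m+n h h)) (ℕP.n<1+n (h ℕ.+ h)) , p∤g ]′
                 (euclidsLemma (h ℕ.+ h) g prime-p p∣2hg))
  ... | yes a≤h | no _    = λ same → a , b ℕ.∸ suc h , a≤h , v≤h b≤p , m%n≡0⇒n∣m _ p (sum≡0 same)
    where
    c = (b ℕ.∸ suc h) ℕ.* (b ℕ.∸ suc h) ℕ.+ 1
    sum≡0 : (a ℕ.* a) % p ≡ (h ℕ.+ h) ℕ.* c % p → (a ℕ.* a ℕ.+ c) % p ≡ 0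
    sum≡0 same = begin
      (a ℕ.* a ℕ.+ c) % p                    ≡⟨ %-distribˡ-+ (a ℕ.* a) c p ⟩
      ((a ℕ.* a) % p ℕ.+ c % p) % p          ≡⟨ cong (λ w → (w ℕ.+ c % p) % p) same ⟩
      ((h ℕ.+ h) ℕ.* c % p ℕ.+ c % p) % p    ≡⟨ sym (%-distribˡ-+ ((h ℕ.+ h) ℕ.* c) c p) ⟩
      ((h ℕ.+ h) ℕ.* c ℕ.+ c) % p            ≡⟨ cong (_% p) (times-p h c) ⟩
      (c ℕ.* p) % p                          ≡⟨ m*n%n≡0 c p ⟩
      0                                      ∎
      where
      open ≡-Reasoning
      times-p : ∀ h c → (h ℕ.+ h) ℕ.* c ℕ.+ c ≡ c ℕ.* suc (h ℕ.+ h)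
      times-p = ℕ-Solver.solve-∀

  remainder : Fin (suc p) → Fin p
  remainder i = fromℕ< (m%n<n (value (toℕ i)) p)

  solution : Solution
  solution with Fin.pigeonhole (ℕP.n<1+n p) remainder
  ... | i , j , i<j , same = collision (toℕ i) (toℕ j) i<j (ℕP.≤-pred (Fin.toℕ<n j))
          (trans (sym (Fin.toℕ-fromℕ< _)) (trans (cong toℕ same) (Fin.toℕ-fromℕ< _)))

  h²-bound : h ℕ.* h ℕ.+ (h ℕ.* h ℕ.+ 1) ℕ.< p ℕ.* p
  h²-bound = subst (h ℕ.* h ℕ.+ (h ℕ.* h ℕ.+ 1) ℕ.<_) (sym (square-p h))
               (ℕP.m<m+n _ (ℕP.<-≤-trans h≥1 (ℕP.≤-trans (ℕP.m≤n+m h (h ℕ.+ h ℕ.+ h)) (ℕP.m≤n+m _ (h ℕ.* h ℕ.+ h ℕ.* h)))))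
    where
    square-p : ∀ h → suc (h ℕ.+ h) ℕ.* suc (h ℕ.+ h)
                     ≡ h ℕ.* h ℕ.+ (h ℕ.* h ℕ.+ 1) ℕ.+ (h ℕ.* h ℕ.+ h ℕ.* h ℕ.+ (h ℕ.+ h ℕ.+ h ℕ.+ h))
    square-p = ℕ-Solver.solve-∀

  fourSquares-p : FourSquares (+ p)
  fourSquares-p with solution
  ... | x , y , x≤h , y≤h , divides m sum≡mp =
    Descent.descent p prime-p m 0<m m<p (fourSquares (+ x) (+ y) 1ℤ 0ℤ mp≡)
    where
    sum = x ℕ.* x ℕ.+ (y ℕ.* y ℕ.+ 1)
    0<sum : 0 ℕ.< sum
    0<sum = ℕP.<-≤-trans (ℕP.m≤n+m 1 (y ℕ.* y)) (ℕP.m≤n+m _ (x ℕ.* x))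
    sum<p² : sum ℕ.< p ℕ.* p
    sum<p² = ℕP.≤-<-trans (ℕP.+-mono-≤ (ℕP.*-mono-≤ x≤h x≤h) (ℕP.+-mono-≤ (ℕP.*-mono-≤ y≤h y≤h) ℕP.≤-refl))
                          h²-bound
    0<m : 0 ℕ.< m
    0<m = ℕP.n≢0⇒n>0 λ m≡0 → ℕP.<⇒≢ 0<sum (sym (trans sum≡mp (cong (ℕ._* p) m≡0)))
    m<p : m ℕ.< p
    m<p = ℕP.*-cancelʳ-< p m p (subst (ℕ._< p ℕ.* p) sum≡mp sum<p²)
    pad : ∀ X Y → X + (Y + 1ℤ) ≡ X + Y + 1ℤ * 1ℤ + 0ℤ * 0ℤ
    pad = solve-∀
    mp≡ : + m * + p ≡ + x * + x + + y * + y + 1ℤ * 1ℤ + 0ℤ * 0ℤ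
    mp≡ = begin
      + m * + p                      ≡⟨ sym (ℤP.pos-* m p) ⟩
      + (m ℕ.* p)                    ≡⟨ cong +_ (sym sum≡mp) ⟩
      + (x ℕ.* x) + (+ (y ℕ.* y) + 1ℤ) ≡⟨ cong₂ (λ X Y → X + (Y + 1ℤ)) (ℤP.pos-* x x) (ℤP.pos-* y y) ⟩
      + x * + x + (+ y * + y + 1ℤ)     ≡⟨ pad (+ x * + x) (+ y * + y) ⟩
      + x * + x + + y * + y + 1ℤ * 1ℤ + 0ℤ * 0ℤ ∎
      where open ≡-Reasoning

parity : ∀ n → (∃ λ h → n ≡ h ℕ.+ h) ⊎ (∃ λ h → n ≡ suc (h ℕ.+ h))
parity zero = inj₁ (0 , refl)
parity (suc n) with parity n
... | inj₁ (h , n≡2h)   = inj₂ (h , cong suc n≡2h)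
... | inj₂ (h , n≡2h+1) = inj₁ (suc h , cong suc (trans n≡2h+1 (sym (ℕP.+-suc h h))))

even-prime-fourSquares : ∀ h → Prime (h ℕ.+ h) → FourSquares (+ (h ℕ.+ h))
even-prime-fourSquares zero prime-0 = ⊥-elim (¬prime[0] prime-0)
even-prime-fourSquares (suc zero) _ = fourSquares 1ℤ 1ℤ 0ℤ 0ℤ refl
even-prime-fourSquares h@(suc (suc k)) prime-2h =
  ⊥-elim (Prime.notComposite prime-2h (composite 2<2h 2∣2h))
  where
  2∣2h : 2 ∣ℕ h ℕ.+ h
  2∣2h = divides h (sym (trans (ℕP.*-comm h 2) (cong (h ℕ.+_) (ℕP.+-identityʳ h))))
  2<2h : 2 ℕ.< h ℕ.+ h
  2<2h = ℕP.<-≤-trans (s≤s (s≤s (s≤s z≤n))) (ℕP.+-mono-≤ (s≤s (s≤s (z≤n {k}))) (ℕP.m≤m+n 2 k))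

prime-fourSquares : ∀ p → Prime p → FourSquares (+ p)
prime-fourSquares p prime-p with parity p
... | inj₁ (h , refl) = even-prime-fourSquares h prime-p
... | inj₂ (h , refl) = SquaresModOddPrime.fourSquares-p h prime-p

lagrange : ∀ n → FourSquares (+ n)
lagrange = <-rec (λ n → FourSquares (+ n)) step
  where
  step : ∀ n → (∀ {k} → k ℕ.< n → FourSquares (+ k)) → FourSquares (+ n)
  step zero       _ = fourSquares 0ℤ 0ℤ 0ℤ 0ℤ refl
  step (suc zero) _ = fourSquares 1ℤ 0ℤ 0ℤ 0ℤ refl
  step n@(suc (suc _)) smaller with prime? n
  ... | yes prime-n = prime-fourSquares n prime-n
  ... | no ¬prime-n with ¬prime⇒composite ¬prime-n
  ... | composite {d} d<n (divides q n≡qd) =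
    subst FourSquares (trans (sym (ℤP.pos-* q d)) (cong +_ (sym n≡qd)))
          (fourSquares-* (smaller (quotient-< (divides q n≡qd))) (smaller d<n))

ZeroOrP₂ : ℕ → ℤ → Set
ZeroOrP₂ r z = z ≡ 0ℤ ⊎ P₂ r z

SumOfFour : (ℤ → Set) → ℤ → Set
SumOfFour P z = ∃ λ u → ∃ λ v → ∃ λ w → ∃ λ t → z ≡ u + v + w + t × P u × P v × P w × P t

-- The hypothesis r ≥ 2 is used only through r ≠ 1.
≥2⇒≢1 : ∀ {r} → 2 ℕ.≤ r → r ≢ 1
≥2⇒≢1 (s≤s (s≤s _)) ()

one∈P₂ : ∀ {r} → 2 ℕ.≤ r → P₂ r 1ℤ
one∈P₂ 2≤r = (1ℤ , refl) , λ r∣1 → ≥2⇒≢1 2≤r (∣1⇒≡1 r∣1)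

unit-combination : ∀ {r} s t u v → s * u + t * v ≡ 1ℤ → + r ∣ s → + r ∣ t → r ≡ 1
unit-combination {r} s t u v comb r∣s r∣t = ∣1⇒≡1 (Signed.∣⇒∣ᵤ (subst (Signed._∣_ (+ r)) comb
  (Signed.∣m∣n⇒∣m+n (Signed.∣m⇒∣m*n {+ r} {s} u (Signed.∣ᵤ⇒∣ {+ r} {s} r∣s))
                    (Signed.∣m⇒∣m*n {+ r} {t} v (Signed.∣ᵤ⇒∣ {+ r} {t} r∣t)))))

-- 2a² + 2 is a sum of four elements of {0} ∪ P₂^r: either a² + a² + 1 + 1, or, when r ∣ a²,
-- (a - 1)² + (a + 1)² + 0 + 0, where neither (a ± 1)² is divisible by r because
-- a² (2a + 3) + (a + 1)² (1 - 2a) = 1 and (a - 1)² (2a + 1) + a² (3 - 2a) = 1.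
twice-square-plus-two : ∀ {r} → 2 ℕ.≤ r → ∀ a → SumOfFour (ZeroOrP₂ r) (a * a + a * a + 1ℤ + 1ℤ)
twice-square-plus-two {r} 2≤r a with r ∣? ∣ a * a ∣
... | no r∤a² = a * a , a * a , 1ℤ , 1ℤ , refl ,
                inj₂ ((a , refl) , r∤a²) , inj₂ ((a , refl) , r∤a²) , inj₂ (one∈P₂ 2≤r) , inj₂ (one∈P₂ 2≤r)
... | yes r∣a² = (a - 1ℤ) * (a - 1ℤ) , (a + 1ℤ) * (a + 1ℤ) , 0ℤ , 0ℤ , regroup a ,
                 inj₂ ((a - 1ℤ , refl) , r∤[a-1]²) , inj₂ ((a + 1ℤ , refl) , r∤[a+1]²) , inj₁ refl , inj₁ refl
  where
  r∤[a+1]² : ¬ (+ r ∣ (a + 1ℤ) * (a + 1ℤ))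
  r∤[a+1]² r∣ = ≥2⇒≢1 2≤r (unit-combination (a * a) ((a + 1ℤ) * (a + 1ℤ)) _ _ (above a) r∣a² r∣)
    where
    above : ∀ a → a * a * (a + a + 1ℤ + 1ℤ + 1ℤ) + (a + 1ℤ) * (a + 1ℤ) * (1ℤ - (a + a)) ≡ 1ℤ
    above = solve-∀
  r∤[a-1]² : ¬ (+ r ∣ (a - 1ℤ) * (a - 1ℤ))
  r∤[a-1]² r∣ = ≥2⇒≢1 2≤r (unit-combination ((a - 1ℤ) * (a - 1ℤ)) (a * a) _ _ (below a) r∣ r∣a²)
    where
    below : ∀ a → (a - 1ℤ) * (a - 1ℤ) * (a + a + 1ℤ) + a * a * (1ℤ + 1ℤ + 1ℤ - (a + a)) ≡ 1ℤ
    below = solve-∀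
  regroup : ∀ a → a * a + a * a + 1ℤ + 1ℤ ≡ (a - 1ℤ) * (a - 1ℤ) + (a + 1ℤ) * (a + 1ℤ) + 0ℤ + 0ℤ
  regroup = solve-∀

zero-sum : ∀ {r} → SumOfFour (ZeroOrP₂ r) 0ℤ
zero-sum = 0ℤ , 0ℤ , 0ℤ , 0ℤ , refl , inj₁ refl , inj₁ refl , inj₁ refl , inj₁ refl

two-sum : ∀ {r} → 2 ℕ.≤ r → SumOfFour (ZeroOrP₂ r) (+ 2)
two-sum 2≤r = 1ℤ , 1ℤ , 0ℤ , 0ℤ , refl , inj₂ (one∈P₂ 2≤r) , inj₂ (one∈P₂ 2≤r) , inj₁ refl , inj₁ refl

-- Every even natural number 2n is a sum of four numbers of the form 2a² + 2, 2 or 0: for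
-- n < 4 use n copies of 2, and for n = k + 4 write k = a² + b² + c² + d² (Lagrange).
double-representable : ∀ {r} → 2 ℕ.≤ r → ∀ n → SumOfFour (SumOfFour (ZeroOrP₂ r)) (+ n + + n)
double-representable 2≤r 0 = 0ℤ , 0ℤ , 0ℤ , 0ℤ , refl , zero-sum , zero-sum , zero-sum , zero-sum
double-representable 2≤r 1 = + 2 , 0ℤ , 0ℤ , 0ℤ , refl , two-sum 2≤r , zero-sum , zero-sum , zero-sum
double-representable 2≤r 2 = + 2 , + 2 , 0ℤ , 0ℤ , refl , two-sum 2≤r , two-sum 2≤r , zero-sum , zero-sum
double-representable 2≤r 3 = + 2 , + 2 , + 2 , 0ℤ , refl , two-sum 2≤r , two-sum 2≤r , two-sum 2≤r , zero-sum
double-representable 2≤r (suc (suc (suc (suc k)))) with lagrange k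
... | fourSquares a b c d k≡ = _ , _ , _ , _ , regroup a b c d (+ k) k≡ ,
        twice-square-plus-two 2≤r a , twice-square-plus-two 2≤r b ,
        twice-square-plus-two 2≤r c , twice-square-plus-two 2≤r d
  where
  regroup : ∀ a b c d K → K ≡ a * a + b * b + c * c + d * d →
    + 4 + K + (+ 4 + K)
    ≡ (a * a + a * a + 1ℤ + 1ℤ) + (b * b + b * b + 1ℤ + 1ℤ) + (c * c + c * c + 1ℤ + 1ℤ) + (d * d + d * d + 1ℤ + 1ℤ)
  regroup a b c d _ refl = expand a b c d
    where
    expand : ∀ a b c d →
      + 4 + (a * a + b * b + c * c + d * d) + (+ 4 + (a * a + b * b + c * c + d * d))
      ≡ (a * a + a * a + 1ℤ + 1ℤ) + (b * b + b * b + 1ℤ + 1ℤ) + (c * c + c * c + 1ℤ + 1ℤ) + (d * d + d * d + 1ℤ + 1ℤ)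
    expand = solve-∀

SumOfFour-nonneg : ∀ {P : ℤ → Set} → (∀ {z} → P z → 0ℤ ≤ z) → ∀ {z} → SumOfFour P z → 0ℤ ≤ z
SumOfFour-nonneg P≥0 (u , v , w , t , refl , pu , pv , pw , pt) =
  ℤP.+-mono-≤ (ℤP.+-mono-≤ (ℤP.+-mono-≤ (P≥0 pu) (P≥0 pv)) (P≥0 pw)) (P≥0 pt)

ZeroOrP₂-nonneg : ∀ {r z} → ZeroOrP₂ r z → 0ℤ ≤ z
ZeroOrP₂-nonneg (inj₁ refl) = ℤP.≤-refl
ZeroOrP₂-nonneg (inj₂ ((k , refl) , _)) = subst (0ℤ ≤_) (sym (square-abs k)) (ℤ.+≤+ z≤n)

Defines : ℕ → (∀ {n} → Term n → PEFormula n) → (ℤ → Set) → Set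
Defines r F P = ∀ {n} (ρ : Env n) (t : Term n) → Sat r (F t) ρ ⇔ P (evalT ρ t)

zeroOrR₂ : ∀ {n} → Term n → PEFormula n
zeroOrR₂ t = (t ≐ zer) ∨ R₂ t

zeroOrR₂-defines : ∀ r → Defines r zeroOrR₂ (ZeroOrP₂ r)
zeroOrR₂-defines r ρ t = mk⇔ (λ z → z) (λ z → z)

weaken : ∀ {n} → Term n → Term (suc n)
weaken (var i) = var (fsuc i)
weaken zer     = zer
weaken (t ⊕ s) = weaken t ⊕ weaken s

eval-weaken : ∀ {n} a (ρ : Env n) t → evalT (extend a ρ) (weaken t) ≡ evalT ρ t
eval-weaken a ρ (var i) = refl
eval-weaken a ρ zer     = refl
eval-weaken a ρ (t ⊕ s) = cong₂ _+_ (eval-weaken a ρ t) (eval-weaken a ρ s)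

weaken⁴ : ∀ {n} → Term n → Term (4 ℕ.+ n)
weaken⁴ t = weaken (weaken (weaken (weaken t)))

eval-weaken⁴ : ∀ {n} a₀ a₁ a₂ a₃ (ρ : Env n) t →
  evalT (extend a₀ (extend a₁ (extend a₂ (extend a₃ ρ)))) (weaken⁴ t) ≡ evalT ρ t
eval-weaken⁴ a₀ a₁ a₂ a₃ ρ t =
  trans (eval-weaken a₀ _ (weaken (weaken (weaken t))))
        (trans (eval-weaken a₁ _ (weaken (weaken t))) (trans (eval-weaken a₂ _ (weaken t)) (eval-weaken a₃ ρ t)))

sumOfFour : (∀ {n} → Term n → PEFormula n) → ∀ {n} → Term n → PEFormula n
sumOfFour F t = ∃' (∃' (∃' (∃' ((weaken⁴ t ≐ (((v₃ ⊕ v₂) ⊕ v₁) ⊕ v₀)) ∧ (F v₃ ∧ (F v₂ ∧ (F v₁ ∧ F v₀)))))))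
  where
  v₀ v₁ v₂ v₃ : Term _
  v₀ = var fzero
  v₁ = var (fsuc fzero)
  v₂ = var (fsuc (fsuc fzero))
  v₃ = var (fsuc (fsuc (fsuc fzero)))

sumOfFour-defines : ∀ {r} {F : ∀ {n} → Term n → PEFormula n} {P : ℤ → Set} →
  Defines r F P → Defines r (sumOfFour F) (SumOfFour P)
sumOfFour-defines F-def ρ t = mk⇔
  (λ (a₃ , a₂ , a₁ , a₀ , t≡ , f₃ , f₂ , f₁ , f₀) →
     a₃ , a₂ , a₁ , a₀ , trans (sym (eval-weaken⁴ a₀ a₁ a₂ a₃ ρ t)) t≡ ,
     to (F-def _ _) f₃ , to (F-def _ _) f₂ , to (F-def _ _) f₁ , to (F-def _ _) f₀)
  (λ (a₃ , a₂ , a₁ , a₀ , t≡ , p₃ , p₂ , p₁ , p₀) →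
     a₃ , a₂ , a₁ , a₀ , trans (eval-weaken⁴ a₀ a₁ a₂ a₃ ρ t) t≡ ,
     from (F-def _ _) p₃ , from (F-def _ _) p₂ , from (F-def _ _) p₁ , from (F-def _ _) p₀)
  where open Equivalence

φ : PEFormula 2
φ = ∃' (((y ⊕ y) ≐ ((x ⊕ x) ⊕ s)) ∧ sumOfFour (sumOfFour zeroOrR₂) s)
  where
  s x y : Term 3
  s = var fzero
  x = var (fsuc fzero)
  y = var (fsuc (fsuc fzero))

φ-meaning : ∀ r x y →
  Sat r φ (env₂ x y) ⇔ ∃ λ s → y + y ≡ x + x + s × SumOfFour (SumOfFour (ZeroOrP₂ r)) s
φ-meaning r x y = mk⇔ (λ (s , eq , sat) → s , eq , to (sixteen (extend s (env₂ x y)) (var fzero)) sat)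
                      (λ (s , eq , sum) → s , eq , from (sixteen (extend s (env₂ x y)) (var fzero)) sum)
  where
  open Equivalence
  sixteen : Defines r (sumOfFour (sumOfFour zeroOrR₂)) (SumOfFour (SumOfFour (ZeroOrP₂ r)))
  sixteen = sumOfFour-defines {F = sumOfFour zeroOrR₂} (sumOfFour-defines {F = zeroOrR₂} (zeroOrR₂-defines r))

≤-from-double-gap : ∀ {x y s} → 0ℤ ≤ s → y + y ≡ x + x + s → x ≤ y
≤-from-double-gap {x} {y} {s} 0≤s eq = ℤP.≮⇒≥ λ y<x →
  ℤP.<-irrefl refl (ℤP.<-≤-trans (ℤP.+-mono-< y<x y<x)
    (subst (x + x ≤_) (sym eq) (subst (_≤ x + x + s) (ℤP.+-identityʳ (x + x)) (ℤP.+-monoʳ-≤ (x + x) 0≤s))))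

double-gap : ∀ {x y} → x ≤ y → y + y ≡ x + x + (+ ∣ y - x ∣ + + ∣ y - x ∣)
double-gap {x} {y} x≤y = trans (gap x y) (cong (λ d → x + x + (d + d)) (sym (ℤP.0≤i⇒+∣i∣≡i (ℤP.i≤j⇒0≤j-i x≤y))))
  where
  gap : ∀ x y → y + y ≡ x + x + ((y - x) + (y - x))
  gap = solve-∀

proposition1p4 : Σ (PEFormula 2) λ φ → (r : ℕ) → 2 Data.Nat.≤ r → (x y : ℤ) → (Sat r φ (env₂ x y) → x ≤ y) × (x ≤ y → Sat r φ (env₂ x y))
proposition1p4 = φ , λ r 2≤r x y →
  let open Equivalence (φ-meaning r x y) in
  (λ sat → let (s , eq , sum) = to sat in ≤-from-double-gap (sixteen-nonneg sum) eq) ,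
  (λ x≤y → from (_ , double-gap x≤y , double-representable 2≤r ∣ y - x ∣))
  where
  sixteen-nonneg : ∀ {r z} → SumOfFour (SumOfFour (ZeroOrP₂ r)) z → 0ℤ ≤ z
  sixteen-nonneg = SumOfFour-nonneg (SumOfFour-nonneg ZeroOrP₂-nonneg)
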